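{- \[ \sum_{m=0}^{\infty}\frac{1}{(m+1)(m+2)}\;{}_0F_1\!\left(\begin{matrix}-\\ m+3\end{matrix}\;\middle|\;1\right)\;=\;I_0(2)-1\approx 1.2795853023360, \] where $I_0$ is the modified Bessel function of the first kind of order $0$.
   Context: ${}_0F_1\!\left(\begin{matrix}-\\ b\end{matrix}\middle| t\right)=\sum_{k=0}^\infty \frac{t^k}{k!\,(b)_k}$ with $(b)_k=\Gamma(b+k)/\Gamma(b)$. $I_0(x)=\sum_{j=0}^\infty \frac{(x/2)^{2j}}{(j!)^2}$. (The left side is the value obtained by formally setting $n=0$ in the series $\sum_{m\ge0}\frac{1}{(m+1)(m+2)}{}_nF_{n-1}(1,\ldots,1;2,\ldots,2,m+3\mid 1)$, called $\zeta^F(0)$ in the paper.) -}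

module Defs where

open import Data.Nat using (ℕ; zero; suc; _+_; _*_; _!)
open import Data.Integer using (+_)
open import Data.Rational using (ℚ; 0ℚ; _/_)
import Data.Rational as Q

sumTo : ℕ → (ℕ → ℚ) → ℚ
sumTo zero    f = 0ℚ
sumTo (suc n) f = sumTo n f Q.+ f n

-- reciprocal of a natural number as a rational: inv d = 1/d for d ≥ 1
-- (convention inv 0 = 0; only ever applied to positive denominators below)
inv : ℕ → ℚ
inv zero    = 0ℚ
inv (suc n) = + 1 / suc n

poch : ℕ → ℕ → ℕ
poch b zero    = 1
poch b (suc k) = poch b k * (b + k)

-- term of 0F1(-; b | t) at t = 1 :  1 / (k! (b)_k)
-- term of the outer series:  1/((m+1)(m+2)) * 1/(k! (m+3)_k)
zetaTerm : ℕ → ℕ → ℚ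
zetaTerm m k = inv ((m + 1) * (m + 2)) Q.* inv ((k !) * poch (m + 3) k)

-- square truncation of the (nonnegative) double series
--   Σ_{m ≥ 0} 1/((m+1)(m+2)) 0F1(-; m+3 | 1)  =  Σ_m Σ_k zetaTerm m k
zetaPartial : ℕ → ℚ
zetaPartial M = sumTo M (λ m → sumTo M (λ k → zetaTerm m k))

-- partial sums of I₀(2) = Σ_j 1/(j!)^2, minus 1
besselPartial : ℕ → ℚ
besselPartial M = sumTo M (λ j → inv ((j !) * (j !))) Q.- Q.1ℚ

{-# OPTIONS --safe #-}
module Submission where

-- Writing 1/(m+1)(m+2) · 1/(k! (m+3)_k) = 1/(k! (m+1)_(k+2)) and using
-- (k+1)/(b)_(k+2) = 1/(b)_(k+1) − 1/(b+1)_(k+1), the sum over m telescopes: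
-- Σ_{m<M} zetaTerm m k = 1/(k+1)!² − 1/((k+1)! (M+1)_(k+1)).
-- Summing over k < M, the first parts give the Bessel partial sum shifted by one
-- index, so the difference of the two partial sums is 1/M!² minus the tail
-- Σ_{k<M} 1/((k+1)! (M+1)_(k+1)) ≤ 2/(M+1); both are nonnegative and tend to 0.

open import Defs
open import Data.Nat.Base as ℕ using (ℕ; zero; suc; _!; z≤n; s≤s)
import Data.Nat.Properties as ℕₚ
import Data.Nat.Solver
open import Data.Nat.Coprimality using (1-coprimeTo) renaming (sym to coprime-sym)
open import Data.Integer.Base as ℤ using (+_; +0; -[1+_])
import Data.Integer.Properties as ℤₚ
open import Data.Rational
  using (ℚ; mkℚ; 0ℚ; 1ℚ; _+_; _*_; _-_; _≤_; _<_; ∣_∣; toℚᵘ; nonNegative; positive)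
open import Data.Rational.Properties
open import Data.Rational.Solver
open import Data.Rational.Unnormalised using (mkℚᵘ; _≃_; *≡*; *≤*; *<*)
import Data.Rational.Unnormalised.Properties as ℚᵘₚ
open import Data.Product using (∃; _,_)
open import Data.Empty using (⊥-elim)
open import Data.Sum using (inj₁; inj₂)
open import Function using (_∘_)
open import Relation.Binary.PropositionalEquality

open +-*-Solver

fromℕ : ℕ → ℚ
fromℕ n = mkℚ (+ n) 0 (coprime-sym (1-coprimeTo n))

fromℕ-+ : ∀ a b → fromℕ (a ℕ.+ b) ≡ fromℕ a + fromℕ b
fromℕ-+ a b = toℚᵘ-injective
  (ℚᵘₚ.≃-trans (*≡* (cong (ℤ._* + 1) (trans (ℤₚ.pos-+ a b)
                     (sym (cong₂ ℤ._+_ (ℤₚ.*-identityʳ (+ a)) (ℤₚ.*-identityʳ (+ b)))))))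
               (ℚᵘₚ.≃-sym (toℚᵘ-homo-+ (fromℕ a) (fromℕ b))))

fromℕ-* : ∀ a b → fromℕ (a ℕ.* b) ≡ fromℕ a * fromℕ b
fromℕ-* a b = toℚᵘ-injective
  (ℚᵘₚ.≃-trans (*≡* (cong (ℤ._* + 1) (ℤₚ.pos-* a b)))
               (ℚᵘₚ.≃-sym (toℚᵘ-homo-* (fromℕ a) (fromℕ b))))

fromℕ-mono-≤ : ∀ {a b} → a ℕ.≤ b → fromℕ a ≤ fromℕ b
fromℕ-mono-≤ {a} {b} a≤b = toℚᵘ-cancel-≤ (*≤*
  (subst₂ ℤ._≤_ (sym (ℤₚ.*-identityʳ (+ a))) (sym (ℤₚ.*-identityʳ (+ b))) (ℤ.+≤+ a≤b)))

toℚᵘ-inv : ∀ n → toℚᵘ (inv (suc n)) ≃ mkℚᵘ (+ 1) n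
toℚᵘ-inv n = toℚᵘ-fromℚᵘ (mkℚᵘ (+ 1) n)

inv-inverseˡ : ∀ n → inv (suc n) * fromℕ (suc n) ≡ 1ℚ
inv-inverseˡ n = toℚᵘ-injective
  (ℚᵘₚ.≃-trans (toℚᵘ-homo-* (inv (suc n)) (fromℕ (suc n)))
  (ℚᵘₚ.≃-trans (ℚᵘₚ.*-congʳ (toℚᵘ-inv n)) (*≡* cross)))
  where
  cross : (+ 1 ℤ.* + suc n) ℤ.* + 1 ≡ + 1 ℤ.* + (suc n ℕ.* 1)
  cross = trans (ℤₚ.*-identityʳ _) (cong (λ d → + 1 ℤ.* + d) (sym (ℕₚ.*-identityʳ (suc n))))

inv-unique : ∀ n x → x * fromℕ (suc n) ≡ 1ℚ → x ≡ inv (suc n)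
inv-unique n x x*[1+n]≡1 = begin
  x                     ≡⟨ *-identityʳ x ⟨
  x * 1ℚ                ≡⟨ cong (x *_) (trans (*-comm c i) (inv-inverseˡ n)) ⟨
  x * (c * i)           ≡⟨ *-assoc x c i ⟨
  x * c * i             ≡⟨ cong (_* i) x*[1+n]≡1 ⟩
  1ℚ * i                ≡⟨ *-identityˡ i ⟩
  i                     ∎
  where
  open ≡-Reasoning
  c = fromℕ (suc n)
  i = inv (suc n)

inv-* : ∀ a b → inv (a ℕ.* b) ≡ inv a * inv b
inv-* zero    b = sym (*-zeroˡ (inv b))
inv-* (suc a) zero rewrite ℕₚ.*-zeroʳ a = sym (*-zeroʳ (inv (suc a)))
inv-* (suc a) (suc b) = sym (inv-unique _ (ia * ib) (begin
  ia * ib * fromℕ (suc a ℕ.* suc b)    ≡⟨ cong (ia * ib *_) (fromℕ-* (suc a) (suc b)) ⟩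
  ia * ib * (ca * cb)                  ≡⟨ solve 4 (λ x y u v → x :* y :* (u :* v) := (x :* u) :* (y :* v))
                                                  refl ia ib ca cb ⟩
  ia * ca * (ib * cb)                  ≡⟨ cong₂ _*_ (inv-inverseˡ a) (inv-inverseˡ b) ⟩
  1ℚ                                   ∎))
  where
  open ≡-Reasoning
  ia = inv (suc a)
  ib = inv (suc b)
  ca = fromℕ (suc a)
  cb = fromℕ (suc b)

inv-*-cancelʳ : ∀ p d → inv (p ℕ.* suc d) * fromℕ (suc d) ≡ inv p
inv-*-cancelʳ p d rewrite inv-* p (suc d) =
  trans (*-assoc (inv p) _ _) (trans (cong (inv p *_) (inv-inverseˡ d)) (*-identityʳ (inv p)))

inv-nonNeg : ∀ n → 0ℚ ≤ inv n
inv-nonNeg zero    = ≤-refl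
inv-nonNeg (suc n) = toℚᵘ-cancel-≤ (ℚᵘₚ.≤-respʳ-≃ (ℚᵘₚ.≃-sym (toℚᵘ-inv n)) (*≤* (ℤ.+≤+ z≤n)))

inv-antimono-≤ : ∀ {a b} → suc a ℕ.≤ b → inv b ≤ inv (suc a)
inv-antimono-≤ {a} {suc b} (s≤s a≤b) = toℚᵘ-cancel-≤
  (ℚᵘₚ.≤-respˡ-≃ (ℚᵘₚ.≃-sym (toℚᵘ-inv b)) (ℚᵘₚ.≤-respʳ-≃ (ℚᵘₚ.≃-sym (toℚᵘ-inv a))
    (*≤* (subst₂ ℤ._≤_ (sym (ℤₚ.*-identityˡ _)) (sym (ℤₚ.*-identityˡ _)) (ℤ.+≤+ (s≤s a≤b))))))

inv-archimedean : ∀ ε → 0ℚ < ε → ∃ λ n → inv (suc n) < ε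
inv-archimedean (mkℚ +0       _ _) 0<ε = ⊥-elim (ℤ.Positive.pos (positive 0<ε))
inv-archimedean (mkℚ -[1+ _ ] _ _) 0<ε = ⊥-elim (ℤ.Positive.pos (positive 0<ε))
inv-archimedean (mkℚ (+ suc p) q _) _ = suc q , toℚᵘ-cancel-<
  (ℚᵘₚ.<-respˡ-≃ (ℚᵘₚ.≃-sym (toℚᵘ-inv (suc q))) (*<* (subst₂ ℤ._<_
    (sym (ℤₚ.*-identityˡ _)) (ℤₚ.pos-* (suc p) (suc (suc q)))
    (ℤ.+<+ (ℕₚ.<-≤-trans (ℕₚ.n<1+n (suc q)) (ℕₚ.m≤n*m (suc (suc q)) (suc p)))))))

inv-half : ∀ n → inv (suc n ℕ.* 2) + inv (suc n ℕ.* 2) ≡ inv (suc n)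
inv-half n = begin
  x + x               ≡⟨ cong₂ _+_ (*-identityʳ x) (*-identityʳ x) ⟨
  x * 1ℚ + x * 1ℚ     ≡⟨ *-distribˡ-+ x 1ℚ 1ℚ ⟨
  x * fromℕ 2         ≡⟨ inv-*-cancelʳ (suc n) 1 ⟩
  inv (suc n)         ∎
  where
  open ≡-Reasoning
  x = inv (suc n ℕ.* 2)

sumTo-cong : ∀ n {f g : ℕ → ℚ} → (∀ i → f i ≡ g i) → sumTo n f ≡ sumTo n g
sumTo-cong zero    f≡g = refl
sumTo-cong (suc n) f≡g = cong₂ _+_ (sumTo-cong n f≡g) (f≡g n)

sumTo-+ : ∀ n (f g : ℕ → ℚ) → sumTo n (λ i → f i + g i) ≡ sumTo n f + sumTo n g
sumTo-+ zero    f g = refl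
sumTo-+ (suc n) f g rewrite sumTo-+ n f g =
  solve 4 (λ a b c d → (a :+ b) :+ (c :+ d) := (a :+ c) :+ (b :+ d)) refl (sumTo n f) (sumTo n g) (f n) (g n)

sumTo-- : ∀ n (f g : ℕ → ℚ) → sumTo n (λ i → f i - g i) ≡ sumTo n f - sumTo n g
sumTo-- zero    f g = refl
sumTo-- (suc n) f g rewrite sumTo-- n f g =
  solve 4 (λ a b c d → (a :- b) :+ (c :- d) := (a :+ c) :- (b :+ d)) refl (sumTo n f) (sumTo n g) (f n) (g n)

sumTo-*ˡ : ∀ n x (f : ℕ → ℚ) → sumTo n (λ i → x * f i) ≡ x * sumTo n f
sumTo-*ˡ zero    x f = sym (*-zeroʳ x)
sumTo-*ˡ (suc n) x f rewrite sumTo-*ˡ n x f = sym (*-distribˡ-+ x (sumTo n f) (f n))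

sumTo-const : ∀ n x → sumTo n (λ _ → x) ≡ fromℕ n * x
sumTo-const zero    x = sym (*-zeroˡ x)
sumTo-const (suc n) x rewrite sumTo-const n x | fromℕ-+ 1 n =
  solve 2 (λ c x → c :* x :+ x := (con 1ℚ :+ c) :* x) refl (fromℕ n) x

sumTo-swap : ∀ n m (f : ℕ → ℕ → ℚ) →
             sumTo n (λ i → sumTo m (f i)) ≡ sumTo m (λ j → sumTo n (λ i → f i j))
sumTo-swap zero    m f = sym (trans (sumTo-const m 0ℚ) (*-zeroʳ (fromℕ m)))
sumTo-swap (suc n) m f rewrite sumTo-swap n m f =
  sym (sumTo-+ m (λ j → sumTo n (λ i → f i j)) (f n))

sumTo-suc : ∀ n (f : ℕ → ℚ) → sumTo (suc n) f ≡ f 0 + sumTo n (f ∘ suc)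
sumTo-suc zero    f = trans (+-identityˡ (f 0)) (sym (+-identityʳ (f 0)))
sumTo-suc (suc n) f rewrite sumTo-suc n f = +-assoc (f 0) (sumTo n (f ∘ suc)) (f (suc n))

sumTo-telescope : ∀ n (f : ℕ → ℚ) → sumTo n (λ i → f i - f (suc i)) ≡ f 0 - f n
sumTo-telescope zero    f = sym (+-inverseʳ (f 0))
sumTo-telescope (suc n) f rewrite sumTo-telescope n f =
  solve 3 (λ a b c → (a :- b) :+ (b :- c) := a :- c) refl (f 0) (f n) (f (suc n))

sumTo-mono-≤ : ∀ n {f g : ℕ → ℚ} → (∀ i → f i ≤ g i) → sumTo n f ≤ sumTo n g
sumTo-mono-≤ zero    f≤g = ≤-refl
sumTo-mono-≤ (suc n) f≤g = +-mono-≤ (sumTo-mono-≤ n f≤g) (f≤g n)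

sumTo-nonNeg : ∀ n {f : ℕ → ℚ} → (∀ i → 0ℚ ≤ f i) → 0ℚ ≤ sumTo n f
sumTo-nonNeg zero    0≤f = ≤-refl
sumTo-nonNeg (suc n) 0≤f = +-mono-≤ (sumTo-nonNeg n 0≤f) (0≤f n)

poch-suc : ∀ b k → poch b (suc k) ≡ b ℕ.* poch (suc b) k
poch-suc b zero = trans (ℕₚ.*-identityˡ (b ℕ.+ 0)) (trans (ℕₚ.+-identityʳ b) (sym (ℕₚ.*-identityʳ b)))
poch-suc b (suc k) = begin
  poch b (suc k) ℕ.* (b ℕ.+ suc k)             ≡⟨ cong (ℕ._* (b ℕ.+ suc k)) (poch-suc b k) ⟩
  b ℕ.* poch (suc b) k ℕ.* (b ℕ.+ suc k)       ≡⟨ ℕₚ.*-assoc b (poch (suc b) k) (b ℕ.+ suc k) ⟩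
  b ℕ.* (poch (suc b) k ℕ.* (b ℕ.+ suc k))     ≡⟨ cong (λ t → b ℕ.* (poch (suc b) k ℕ.* t)) (ℕₚ.+-suc b k) ⟩
  b ℕ.* (poch (suc b) k ℕ.* (suc b ℕ.+ k))     ∎
  where open ≡-Reasoning

poch-1 : ∀ n → poch 1 n ≡ n !
poch-1 zero    = refl
poch-1 (suc n) rewrite poch-1 n = ℕₚ.*-comm (n !) (suc n)

poch-positive : ∀ b k → 1 ℕ.≤ poch (suc b) k
poch-positive b zero    = s≤s z≤n
poch-positive b (suc k) = ℕₚ.*-mono-≤ (poch-positive b k) (s≤s z≤n)

poch-≥ : ∀ b k → suc b ℕ.≤ poch (suc b) (suc k)
poch-≥ b k = subst (suc b ℕ.≤_) (sym (poch-suc (suc b) k))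
  (subst (ℕ._≤ suc b ℕ.* poch (suc (suc b)) k) (ℕₚ.*-identityʳ (suc b))
         (ℕₚ.*-monoʳ-≤ (suc b) (poch-positive (suc b) k)))

-- (k+1)/(b)_(k+2) = ((b+k+1) − b)/(b)_(k+2), and (b)_(k+2) is both (b)_(k+1) (b+k+1) and b (b+1)_(k+1).
inv-poch-difference : ∀ b k →
  fromℕ (suc k) * inv (poch (suc b) (suc (suc k))) ≡
  inv (poch (suc b) (suc k)) - inv (poch (suc (suc b)) (suc k))
inv-poch-difference b k = begin
  fromℕ (suc k) * x
    ≡⟨ solve 3 (λ x a c → c :* x := x :* (a :+ c) :- x :* a) refl x (fromℕ (suc b)) (fromℕ (suc k)) ⟩
  x * (fromℕ (suc b) + fromℕ (suc k)) - x * fromℕ (suc b)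
    ≡⟨ cong₂ (λ y z → x * y - inv z * fromℕ (suc b))
             (sym (fromℕ-+ (suc b) (suc k))) (poch-suc (suc b) (suc k)) ⟩
  x * fromℕ (suc b ℕ.+ suc k) - inv (suc b ℕ.* next) * fromℕ (suc b)
    ≡⟨ cong (λ n → x * fromℕ (suc b ℕ.+ suc k) - inv n * fromℕ (suc b)) (ℕₚ.*-comm (suc b) next) ⟩
  x * fromℕ (suc b ℕ.+ suc k) - inv (next ℕ.* suc b) * fromℕ (suc b)
    ≡⟨ cong₂ _-_ (inv-*-cancelʳ (poch (suc b) (suc k)) (b ℕ.+ suc k)) (inv-*-cancelʳ next b) ⟩
  inv (poch (suc b) (suc k)) - inv next
    ∎
  where
  open ≡-Reasoning
  x = inv (poch (suc b) (suc (suc k)))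
  next = poch (suc (suc b)) (suc k)

inv-poch-sum : ∀ k M →
  fromℕ (suc k) * sumTo M (λ m → inv (poch (suc m) (suc (suc k)))) ≡
  inv (suc k !) - inv (poch (suc M) (suc k))
inv-poch-sum k M = begin
  fromℕ (suc k) * sumTo M (λ m → inv (poch (suc m) (suc (suc k))))
    ≡⟨ sumTo-*ˡ M (fromℕ (suc k)) _ ⟨
  sumTo M (λ m → fromℕ (suc k) * inv (poch (suc m) (suc (suc k))))
    ≡⟨ sumTo-cong M (λ m → inv-poch-difference m k) ⟩
  sumTo M (λ m → inv (poch (suc m) (suc k)) - inv (poch (suc (suc m)) (suc k)))
    ≡⟨ sumTo-telescope M (λ m → inv (poch (suc m) (suc k))) ⟩
  inv (poch 1 (suc k)) - inv (poch (suc M) (suc k))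
    ≡⟨ cong (λ n → inv n - inv (poch (suc M) (suc k))) (poch-1 (suc k)) ⟩
  inv (suc k !) - inv (poch (suc M) (suc k))
    ∎
  where open ≡-Reasoning

zetaTerm-poch : ∀ m k → zetaTerm m k ≡ inv (k !) * inv (poch (suc m) (suc (suc k)))
zetaTerm-poch m k = begin
  zetaTerm m k
    ≡⟨ inv-* ((m ℕ.+ 1) ℕ.* (m ℕ.+ 2)) (k ! ℕ.* poch (m ℕ.+ 3) k) ⟨
  inv ((m ℕ.+ 1) ℕ.* (m ℕ.+ 2) ℕ.* (k ! ℕ.* poch (m ℕ.+ 3) k))
    ≡⟨ cong inv denominator ⟩
  inv (k ! ℕ.* poch (suc m) (suc (suc k)))
    ≡⟨ inv-* (k !) (poch (suc m) (suc (suc k))) ⟩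
  inv (k !) * inv (poch (suc m) (suc (suc k)))
    ∎
  where
  open ≡-Reasoning
  open Data.Nat.Solver.+-*-Solver using () renaming (solve to solveℕ; _:+_ to _⊕_; _:*_ to _⊗_; _:=_ to _≐_; con to num)
  rest = poch (3 ℕ.+ m) k
  denominator : (m ℕ.+ 1) ℕ.* (m ℕ.+ 2) ℕ.* (k ! ℕ.* poch (m ℕ.+ 3) k) ≡ k ! ℕ.* poch (suc m) (suc (suc k))
  denominator = begin
    (m ℕ.+ 1) ℕ.* (m ℕ.+ 2) ℕ.* (k ! ℕ.* poch (m ℕ.+ 3) k)
      ≡⟨ cong (λ b → (m ℕ.+ 1) ℕ.* (m ℕ.+ 2) ℕ.* (k ! ℕ.* poch b k)) (ℕₚ.+-comm m 3) ⟩
    (m ℕ.+ 1) ℕ.* (m ℕ.+ 2) ℕ.* (k ! ℕ.* rest)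
      ≡⟨ solveℕ 3 (λ m f r → (m ⊕ num 1) ⊗ (m ⊕ num 2) ⊗ (f ⊗ r) ≐ f ⊗ ((num 1 ⊕ m) ⊗ ((num 2 ⊕ m) ⊗ r)))
                refl m (k !) rest ⟩
    k ! ℕ.* (suc m ℕ.* (suc (suc m) ℕ.* rest))
      ≡⟨ cong (λ n → k ! ℕ.* (suc m ℕ.* n)) (poch-suc (suc (suc m)) k) ⟨
    k ! ℕ.* (suc m ℕ.* poch (suc (suc m)) (suc k))
      ≡⟨ cong (k ! ℕ.*_) (poch-suc (suc m) (suc k)) ⟨
    k ! ℕ.* poch (suc m) (suc (suc k))
      ∎

besselTerm : ℕ → ℚ
besselTerm j = inv (j ! ℕ.* j !)

-- The part of the k-th column that the truncation at m < M cuts off.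
tailTerm : ℕ → ℕ → ℚ
tailTerm M k = inv (suc k !) * inv (poch (suc M) (suc k))

zetaTail : ℕ → ℚ
zetaTail M = sumTo M (tailTerm M)

zetaColumn : ∀ M k → sumTo M (λ m → zetaTerm m k) ≡ besselTerm (suc k) - tailTerm M k
zetaColumn M k = begin
  sumTo M (λ m → zetaTerm m k)
    ≡⟨ sumTo-cong M (λ m → zetaTerm-poch m k) ⟩
  sumTo M (λ m → inv (k !) * y m)
    ≡⟨ sumTo-*ˡ M (inv (k !)) y ⟩
  inv (k !) * s
    ≡⟨ cong (inv (k !) *_) (*-identityˡ s) ⟨
  inv (k !) * (1ℚ * s)
    ≡⟨ cong (λ z → inv (k !) * (z * s)) (inv-inverseˡ k) ⟨
  inv (k !) * (inv (suc k) * fromℕ (suc k) * s)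
    ≡⟨ solve 4 (λ i j c t → i :* (j :* c :* t) := j :* i :* (c :* t)) refl (inv (k !)) (inv (suc k)) (fromℕ (suc k)) s ⟩
  inv (suc k) * inv (k !) * (fromℕ (suc k) * s)
    ≡⟨ cong₂ _*_ (inv-* (suc k) (k !)) (sym (inv-poch-sum k M)) ⟨
  f * (f - u)
    ≡⟨ solve 2 (λ f u → f :* (f :- u) := f :* f :- f :* u) refl f u ⟩
  f * f - f * u
    ≡⟨ cong (_- f * u) (inv-* (suc k !) (suc k !)) ⟨
  besselTerm (suc k) - tailTerm M k
    ∎
  where
  open ≡-Reasoning
  y = λ m → inv (poch (suc m) (suc (suc k)))
  s = sumTo M y
  f = inv (suc k !)
  u = inv (poch (suc M) (suc k))

zetaPartial-besselPartial : ∀ M → zetaPartial M - besselPartial M ≡ besselTerm M - zetaTail M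
zetaPartial-besselPartial M = begin
  zetaPartial M - (s - 1ℚ)
    ≡⟨ cong (_- (s - 1ℚ)) (sumTo-swap M M zetaTerm) ⟩
  sumTo M (λ k → sumTo M (λ m → zetaTerm m k)) - (s - 1ℚ)
    ≡⟨ cong (_- (s - 1ℚ)) (sumTo-cong M (zetaColumn M)) ⟩
  sumTo M (λ k → besselTerm (suc k) - tailTerm M k) - (s - 1ℚ)
    ≡⟨ cong (_- (s - 1ℚ)) (sumTo-- M (besselTerm ∘ suc) (tailTerm M)) ⟩
  (t - zetaTail M) - (s - 1ℚ)
    ≡⟨ solve 4 (λ s e t o → (t :- e) :- (s :- o) := (o :+ t) :- s :- e) refl s (zetaTail M) t 1ℚ ⟩
  1ℚ + t - s - zetaTail M
    ≡⟨ cong (λ z → z - s - zetaTail M) (sumTo-suc M besselTerm) ⟨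
  s + besselTerm M - s - zetaTail M
    ≡⟨ solve 3 (λ s a e → s :+ a :- s :- e := a :- e) refl s (besselTerm M) (zetaTail M) ⟩
  besselTerm M - zetaTail M
    ∎
  where
  open ≡-Reasoning
  s = sumTo M besselTerm
  t = sumTo M (besselTerm ∘ suc)

besselTerm-nonNeg : ∀ M → 0ℚ ≤ besselTerm M
besselTerm-nonNeg M = inv-nonNeg (M ! ℕ.* M !)

besselTerm-≤ : ∀ {n M} → suc n ℕ.≤ M → besselTerm M ≤ inv (suc n)
besselTerm-≤ {n} {M} n<M = inv-antimono-≤
  (ℕₚ.≤-trans n<M (ℕₚ.≤-trans (n≤n! M) (ℕₚ.m≤m*n (M !) (M !) {{ℕₚ._!≢0 M}})))
  where
  n≤n! : ∀ n → n ℕ.≤ n !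
  n≤n! zero    = z≤n
  n≤n! (suc n) = ℕₚ.m≤m*n (suc n) (n !) {{ℕₚ._!≢0 n}}

*-nonNeg : ∀ {x y} → 0ℚ ≤ x → 0ℚ ≤ y → 0ℚ ≤ x * y
*-nonNeg {x} 0≤x 0≤y = subst (_≤ x * _) (*-zeroʳ x) (*-monoˡ-≤-nonNeg x {{nonNegative 0≤x}} 0≤y)

zetaTail-nonNeg : ∀ M → 0ℚ ≤ zetaTail M
zetaTail-nonNeg M = sumTo-nonNeg M (λ k → *-nonNeg (inv-nonNeg (suc k !)) (inv-nonNeg (poch (suc M) (suc k))))

tailTerm-zero-≤ : ∀ M → tailTerm M 0 ≤ inv (suc M)
tailTerm-zero-≤ M = subst (_≤ inv (suc M)) (sym (*-identityˡ _)) (inv-antimono-≤ (poch-≥ M 0))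

tailTerm-suc-≤ : ∀ M k → tailTerm M (suc k) ≤ inv (suc M ℕ.* suc M)
tailTerm-suc-≤ M k = subst (_≤ inv (suc M ℕ.* suc M)) (inv-* (suc (suc k) !) p) (inv-antimono-≤ square≤)
  where
  p = poch (suc M) (suc (suc k))
  square≤ : suc M ℕ.* suc M ℕ.≤ suc (suc k) ! ℕ.* p
  square≤ = ℕₚ.≤-trans
    (subst (suc M ℕ.* suc M ℕ.≤_) (sym (poch-suc (suc M) (suc k)))
           (ℕₚ.*-monoʳ-≤ (suc M) (ℕₚ.≤-trans (ℕₚ.n≤1+n (suc M)) (poch-≥ (suc M) k))))
    (ℕₚ.m≤n*m p (suc (suc k) !) {{ℕₚ._!≢0 (suc (suc k))}})

-- The k = 0 term is 1/(M+1); the M−1 others are each at most 1/(M+1)².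
zetaTail-≤ : ∀ M → zetaTail M ≤ inv (suc M) + inv (suc M)
zetaTail-≤ zero = +-mono-≤ (inv-nonNeg 1) (inv-nonNeg 1)
zetaTail-≤ (suc M) = subst (_≤ inv (suc (suc M)) + inv (suc (suc M))) (sym (sumTo-suc M (tailTerm (suc M))))
  (+-mono-≤ (tailTerm-zero-≤ (suc M)) (begin
    sumTo M (tailTerm (suc M) ∘ suc)   ≤⟨ sumTo-mono-≤ M (tailTerm-suc-≤ (suc M)) ⟩
    sumTo M (λ _ → sq)                 ≡⟨ sumTo-const M sq ⟩
    fromℕ M * sq                       ≤⟨ *-monoʳ-≤-nonNeg sq {{nonNegative (inv-nonNeg (suc (suc M) ℕ.* suc (suc M)))}}
                                             (fromℕ-mono-≤ (ℕₚ.m≤n⇒m≤1+n (ℕₚ.n≤1+n M))) ⟩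
    fromℕ (suc (suc M)) * sq           ≡⟨ *-comm _ sq ⟩
    sq * fromℕ (suc (suc M))           ≡⟨ inv-*-cancelʳ (suc (suc M)) (suc M) ⟩
    inv (suc (suc M))                  ∎))
  where
  open ≤-Reasoning
  sq = inv (suc (suc M) ℕ.* suc (suc M))

p-q≤p : ∀ p {q} → 0ℚ ≤ q → p - q ≤ p
p-q≤p p 0≤q = subst (p - _ ≤_) (+-identityʳ p) (+-monoʳ-≤ p (neg-antimono-≤ 0≤q))

∣p-q∣<r : ∀ {p q r} → 0ℚ ≤ p → p < r → 0ℚ ≤ q → q < r → ∣ p - q ∣ < r
∣p-q∣<r {p} {q} {r} 0≤p p<r 0≤q q<r with ∣p∣≡p∨∣p∣≡-p (p - q)
... | inj₁ ∣p-q∣≡p-q = subst (_< r) (sym ∣p-q∣≡p-q) (≤-<-trans (p-q≤p p 0≤q) p<r)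
... | inj₂ ∣p-q∣≡q-p = subst (_< r) (sym (trans ∣p-q∣≡q-p (solve 2 (λ p q → :- (p :- q) := q :- p) refl p q)))
                              (≤-<-trans (p-q≤p q 0≤p) q<r)

zetaTail-≤-inv : ∀ {n M} → suc n ℕ.* 2 ℕ.≤ M → zetaTail M ≤ inv (suc n)
zetaTail-≤-inv {n} {M} 2[1+n]≤M = begin
  zetaTail M                                ≤⟨ zetaTail-≤ M ⟩
  inv (suc M) + inv (suc M)                 ≤⟨ +-mono-≤ 1/[1+M]≤ 1/[1+M]≤ ⟩
  inv (suc n ℕ.* 2) + inv (suc n ℕ.* 2)     ≡⟨ inv-half n ⟩
  inv (suc n)                               ∎
  where
  open ≤-Reasoning
  1/[1+M]≤ : inv (suc M) ≤ inv (suc n ℕ.* 2)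
  1/[1+M]≤ = inv-antimono-≤ (ℕₚ.m≤n⇒m≤1+n 2[1+n]≤M)

mainTheorem3 : (ε : ℚ) → 0ℚ < ε →
    ∃ λ (N : ℕ) → (M : ℕ) → N ℕ.≤ M →
    ∣ zetaPartial M - besselPartial M ∣ < ε
mainTheorem3 ε 0<ε with inv-archimedean ε 0<ε
... | n , 1/[1+n]<ε = suc n ℕ.* 2 , λ M N≤M →
  subst (_< ε) (cong ∣_∣ (sym (zetaPartial-besselPartial M)))
    (∣p-q∣<r (besselTerm-nonNeg M)
             (≤-<-trans (besselTerm-≤ {n} (ℕₚ.≤-trans (ℕₚ.m≤m*n (suc n) 2) N≤M)) 1/[1+n]<ε)
             (zetaTail-nonNeg M)
             (≤-<-trans (zetaTail-≤-inv {n} N≤M) 1/[1+n]<ε))
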